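{- Let $A$ be a finite alphabet and let $F$ be a diamond-uniform dill map on $A^{\mathbb N}$ with local rule $f$ and diameter $\theta$. Then $F$ is $(2\theta-1)\frac{\|f\|^+}{\|f\|^- }$-Lipschitz with respect to $W_L$, i.e. $W_L(F(x),F(y))\le (2\theta-1)\frac{\|f\|^+}{\|f\|^- }W_L(x,y)$ for all $x,y\in A^{\mathbb N}$.
   Context: Write $u_{[a,b)}=u_a\cdots u_{b-1}$. The Levenshtein distance $d_L(u,v)$ of finite words is $\frac12\min\{m+m'\}$ over all ways of deleting $m$ letters from $u$ and $m'$ letters from $v$ so that the results coincide. $W_L(x,y)=\limsup_{\ell\to\infty}\max_{k\in\mathbb N}\frac{d_L(x_{[k,k+\ell)},y_{[k,k+\ell)})}{\ell}$. A dill map with diameter $\theta\ge1$ and local rule $f:A^\theta\to A^+$ is $F(x)=f(x_{[0,\theta)})f(x_{[1,\theta+1)})\cdots$; $\|f\|^-=\min_{u\in A^\theta}|f(u)|$, $\|f\|^+=\max_{u\in A^\theta}|f(u)|$. Let $f^*(u)=f(u_{[0,\theta)})f(u_{[1,\theta+1)})\cdots f(u_{[|u|-\theta,|u|)})$ for $|u|\ge\theta$, and the empty word otherwise. $F$ is diamond-uniform if for every $\ell$ and all $u,v\in A^\ell$ with $u_{[0,\theta)}=v_{[0,\theta)}$ and $u_{[\ell-\theta,\ell)}=v_{[\ell-\theta,\ell)}$, one has $|f^*(u)|=|f^*(v)|$. -}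

module Defs where

open import Data.Nat as ℕ using (ℕ; zero; suc; _+_; _∸_; _≤_)
open import Data.Fin using (Fin)
open import Data.List as List using (List; []; _∷_; _++_; length; upTo)
open import Data.List.NonEmpty as List⁺ using (List⁺; toList)
open import Data.List.Relation.Binary.Sublist.Propositional using (_⊆_)
open import Data.Vec as Vec using (Vec; []; _∷_; tabulate; reverse)
open import Data.Maybe as Maybe using (Maybe; just; nothing; maybe)
open import Data.Product using (Σ; ∃; ∃-syntax; _×_; _,_)
open import Data.Integer using (+_)
open import Data.Rational as ℚ using (ℚ)
open import Relation.Binary.PropositionalEquality using (_≡_)

ℕ→ℚ : ℕ → ℚ
ℕ→ℚ n = + n ℚ./ 1

module _ {A : Set} where

  -- Levenshtein distance (insert/delete), as in the paper:
  -- d_L(u,v) = 1/2 min (m + m') over deletions making u and v coincide.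
  -- Deleting letters from u and v so the results coincide = choosing a
  -- common sublist w; then m + m' = |u| + |v| - 2|w|.
  -- "d_L(u,v) ≤ s" (s rational) is stated as: some such deletion achieves
  -- (m + m')/2 ≤ s.
  dL≤ : List A → List A → ℚ → Set
  dL≤ u v s = ∃[ w ] (w ⊆ u × w ⊆ v ×
                ℕ→ℚ ((length u + length v) ∸ (length w + length w)) ℚ.≤ ℕ→ℚ 2 ℚ.* s)

  factor : (ℕ → A) → ℕ → ℕ → List A
  factor x k ℓ = List.map (λ i → x (k + i)) (upTo ℓ)

  -- Upper bounds on W_L(x,y) = limsup_ℓ max_k d_L(x_[k,k+ℓ), y_[k,k+ℓ)) / ℓ.
  -- WithinEventually x y q : for all sufficiently large ℓ and all k,
  --   d_L(x_[k,k+ℓ), y_[k,k+ℓ)) ≤ q ℓ.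
  WithinEventually : (ℕ → A) → (ℕ → A) → ℚ → Set
  WithinEventually x y q =
    ∃[ N ] (∀ ℓ → N ≤ ℓ → ∀ k → dL≤ (factor x k ℓ) (factor y k ℓ) (q ℚ.* ℕ→ℚ ℓ))

  module Dill {θ : ℕ} (f : Vec A θ → List⁺ A) where

    window : (ℕ → A) → ℕ → Vec A θ
    window x j = tabulate (λ k → x (j + Data.Fin.toℕ k))

    -- letter number i of the concatenation f(x_[j,j+θ)) f(x_[j+1,j+1+θ)) ...
    -- (fuel: each block has length ≥ 1, so fuel i+1 always suffices;
    --  the fuel-exhausted branch is never reached)
    emit : (ℕ → A) → ℕ → ℕ → ℕ → A
    emit x j i zero = List⁺.head (f (window x j))
    emit x j i (suc k) = go (toList (f (window x j))) i
      where
      go : List A → ℕ → A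
      go [] i = emit x (suc j) i k
      go (a ∷ as) zero = a
      go (a ∷ as) (suc i) = go as i

    F : (ℕ → A) → (ℕ → A)
    F x i = emit x 0 i (suc i)

    prefix : ∀ {ℓ} (n : ℕ) → Vec A ℓ → Maybe (Vec A n)
    prefix zero _ = just []
    prefix (suc n) [] = nothing
    prefix (suc n) (a ∷ u) = Maybe.map (a ∷_) (prefix n u)

    suffix : ∀ {ℓ} (n : ℕ) → Vec A ℓ → Maybe (Vec A n)
    suffix n u = Maybe.map reverse (prefix n (reverse u))

    fstar : ∀ {ℓ} → Vec A ℓ → List A
    fstar [] = []
    fstar (a ∷ u) = maybe (λ w → toList (f w) ++ fstar u) [] (prefix θ (a ∷ u))

    DiamondUniform : Set
    DiamondUniform = ∀ ℓ → θ ≤ ℓ → (u v : Vec A ℓ) →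
      prefix θ u ≡ prefix θ v → suffix θ u ≡ suffix θ v →
      length (fstar u) ≡ length (fstar v)

    IsMinNorm : ℕ → Set
    IsMinNorm m = (∀ u → m ≤ List⁺.length (f u)) × (∃[ u ] (List⁺.length (f u) ≡ m))

    IsMaxNorm : ℕ → Set
    IsMaxNorm M = (∀ u → List⁺.length (f u) ≤ M) × (∃[ u ] (List⁺.length (f u) ≡ M))

{-# OPTIONS --safe #-}

-- F(x) is the concatenation of the blocks f(x_[j,j+θ)). Deleting or inserting one
-- input letter changes its own block (at most ‖f‖⁺ letters) and may change, on both
-- sides, the θ−1 blocks whose windows start to its left and still contain it; so a
-- common subsequence of two input words with indel cost D yields one of their
-- f*-images with indel cost at most (2θ−1)‖f‖⁺·D. Diamond uniformity keeps the
-- starting positions of the blocks of F(x) and F(y) within 2θ‖f‖⁺ of each other, so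
-- F(x)_[k,k+ℓ) and F(y)_[k,k+ℓ) are, up to bounded margins, the f*-images of the
-- same input windows x_[a,a+L) and y_[a,a+L), where L‖f‖⁻ ≤ ℓ + O(1). The bounded
-- errors disappear in the limit thanks to the strict inequality assumed on q and r.
module Submission where

open import Defs
open import Data.Nat using (ℕ; _≤_; _∸_; _*_)
open import Data.Fin using (Fin)
open import Data.Vec using (Vec)
open import Data.List.NonEmpty using (List⁺)
open import Data.Rational as ℚ using (ℚ)

open import Data.Empty using (⊥-elim)
open import Data.Fin using (toℕ)
open import Data.Integer as ℤ using (-[1+_])
import Data.Integer.Properties as ℤₚ
open import Data.List as List using (List; []; _∷_; _++_; length; applyUpTo)
open import Data.List.NonEmpty as List⁺ using (toList)
open import Data.List.Properties using (length-++; ++-assoc; map-upTo; reverse-++; length-reverse)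
open import Data.List.Relation.Binary.Sublist.Propositional using (_⊆_; []; _∷_; _∷ʳ_; ⊆-refl; ⊆-trans)
open import Data.List.Relation.Binary.Sublist.Propositional.Properties using (++⁺; ++⁺ˡ; ++⁺ʳ; length-mono-≤)
open import Data.Maybe as Maybe using (Maybe; just; nothing; maybe)
open import Data.Maybe.Properties using (just-injective)
open import Data.Nat using (zero; suc; _+_; _<_; z≤n; s≤s; _≤?_; _<?_; >-nonZero)
open import Data.Nat.Coprimality using (1-coprimeTo) renaming (sym to coprime-sym)
open import Data.Nat.Properties
open import Algebra.Properties.CommutativeSemigroup +-commutativeSemigroup using (x∙yz≈y∙xz)
open import Data.Nat.Solver using (module +-*-Solver)
open import Data.Product using (Σ; ∃-syntax; _×_; _,_; proj₁; proj₂)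
open import Data.Rational using (mkℚ; 0ℚ; *≤*; *<*; NonNegative; Positive)
import Data.Rational.Properties as ℚₚ
import Data.Rational.Solver as ℚ-Solver
import Data.Rational.Unnormalised as ℚᵘ
import Data.Rational.Unnormalised.Properties as ℚᵘₚ
open import Data.Sum using (_⊎_; inj₁; inj₂; [_,_]; swap)
import Data.Vec as Vec
import Data.Vec.Properties as Vecₚ
open import Function using (_∘_; _⇔_; mk⇔; Equivalence)
open import Relation.Binary.PropositionalEquality
  using (_≡_; refl; sym; trans; cong; cong₂; subst; subst₂; module ≡-Reasoning)
open import Relation.Nullary using (¬_; yes; no; _×-dec_; _⊎-dec_)
open import Relation.Unary using (Decidable)

ℕ→ℚ≡mkℚ : ∀ n → ℕ→ℚ n ≡ mkℚ (ℤ.+ n) 0 (coprime-sym (1-coprimeTo n))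
ℕ→ℚ≡mkℚ n = ℚₚ.normalize-coprime (coprime-sym (1-coprimeTo n))

ℕ→ℚ-+ : ∀ m n → ℕ→ℚ (m + n) ≡ ℕ→ℚ m ℚ.+ ℕ→ℚ n
ℕ→ℚ-+ m n rewrite ℕ→ℚ≡mkℚ m | ℕ→ℚ≡mkℚ n =
  cong (ℚ._/ 1) (cong₂ ℤ._+_ (sym (ℤₚ.*-identityʳ (ℤ.+ m))) (sym (ℤₚ.*-identityʳ (ℤ.+ n))))

ℕ→ℚ-* : ∀ m n → ℕ→ℚ (m * n) ≡ ℕ→ℚ m ℚ.* ℕ→ℚ n
ℕ→ℚ-* m n rewrite ℕ→ℚ≡mkℚ m | ℕ→ℚ≡mkℚ n = cong (ℚ._/ 1) (sym (ℤₚ.+◃n≡+n (m * n)))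

ℕ→ℚ-mono-≤ : ∀ {m n} → m ≤ n → ℕ→ℚ m ℚ.≤ ℕ→ℚ n
ℕ→ℚ-mono-≤ {m} {n} m≤n rewrite ℕ→ℚ≡mkℚ m | ℕ→ℚ≡mkℚ n =
  *≤* (subst₂ ℤ._≤_ (sym (ℤₚ.*-identityʳ (ℤ.+ m))) (sym (ℤₚ.*-identityʳ (ℤ.+ n))) (ℤ.+≤+ m≤n))

ℕ→ℚ-mono-< : ∀ {m n} → m < n → ℕ→ℚ m ℚ.< ℕ→ℚ n
ℕ→ℚ-mono-< {m} {n} m<n rewrite ℕ→ℚ≡mkℚ m | ℕ→ℚ≡mkℚ n =
  *<* (subst₂ ℤ._<_ (sym (ℤₚ.*-identityʳ (ℤ.+ m))) (sym (ℤₚ.*-identityʳ (ℤ.+ n))) (ℤ.+<+ m<n))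

ℕ→ℚ-nonNeg : ∀ n → NonNegative (ℕ→ℚ n)
ℕ→ℚ-nonNeg n = ℚ.nonNegative (ℕ→ℚ-mono-≤ {0} {n} z≤n)

ℕ→ℚ-pos : ∀ n → 1 ≤ n → Positive (ℕ→ℚ n)
ℕ→ℚ-pos n 1≤n = ℚ.positive (ℕ→ℚ-mono-< 1≤n)

≤-ℕ→ℚ∣↥∣ : ∀ p → p ℚ.≤ ℕ→ℚ ℤ.∣ ℚ.↥ p ∣
≤-ℕ→ℚ∣↥∣ (mkℚ (ℤ.+ k) d _) rewrite ℕ→ℚ≡mkℚ k =
  *≤* (subst₂ ℤ._≤_ (sym (ℤₚ.+◃n≡+n (k * 1))) (sym (ℤₚ.+◃n≡+n (k * suc d))) (ℤ.+≤+ (*-monoʳ-≤ k (s≤s z≤n))))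
≤-ℕ→ℚ∣↥∣ (mkℚ -[1+ k ] d _) rewrite ℕ→ℚ≡mkℚ (suc k) =
  *≤* (subst₂ ℤ._≤_ (sym (ℤₚ.*-identityʳ -[1+ k ])) (sym (ℤₚ.+◃n≡+n (suc k * suc d))) ℤ.-≤+)

archimedean : ∀ {ε} → 0ℚ ℚ.< ε → ∀ p → ∃[ n ] (p ℚ.≤ ε ℚ.* ℕ→ℚ n)
archimedean {mkℚ (ℤ.+ zero) _ _} 0<ε p = ⊥-elim (ℤ.Positive.pos (ℚ.positive 0<ε))
archimedean {mkℚ -[1+ _ ] _ _} 0<ε p = ⊥-elim (ℤ.Positive.pos (ℚ.positive 0<ε))
archimedean {ε@(mkℚ (ℤ.+ suc e) d _)} 0<ε p = a * suc d , ℚₚ.≤-trans (≤-ℕ→ℚ∣↥∣ p) a≤ε*n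
  where
  a = ℤ.∣ ℚ.↥ p ∣
  n = a * suc d
  -- ε = (e+1)/(d+1), so ε · a(d+1) = (e+1)·a ≥ a.
  a≤ε*n : ℕ→ℚ a ℚ.≤ ε ℚ.* ℕ→ℚ n
  a≤ε*n = ℚₚ.toℚᵘ-cancel-≤ (ℚᵘₚ.≤-respʳ-≃ (ℚᵘₚ.≃-sym (ℚₚ.toℚᵘ-homo-* ε (ℕ→ℚ n))) unnormalised)
    where
    unnormalised : ℚ.toℚᵘ (ℕ→ℚ a) ℚᵘ.≤ ℚ.toℚᵘ ε ℚᵘ.* ℚ.toℚᵘ (ℕ→ℚ n)
    unnormalised rewrite ℕ→ℚ≡mkℚ a | ℕ→ℚ≡mkℚ n = ℚᵘ.*≤* (subst₂ ℤ._≤_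
      (sym (ℤₚ.+◃n≡+n (a * suc (d * 1))))
      (sym (trans (ℤₚ.*-identityʳ (ℤ.+ suc e ℤ.* ℤ.+ n)) (ℤₚ.+◃n≡+n (suc e * n))))
      (ℤ.+≤+ (subst (_≤ suc e * n) (cong (λ z → a * suc z) (sym (*-identityʳ d))) (m≤m+n n (e * n)))))

nonNeg-of-≤-scaled : ∀ {q} D L → 1 ≤ L → ℕ→ℚ D ℚ.≤ ℕ→ℚ 2 ℚ.* (q ℚ.* ℕ→ℚ L) → 0ℚ ℚ.≤ q
nonNeg-of-≤-scaled {q} D L 1≤L D≤ = ℚₚ.*-cancelʳ-≤-pos (two ℚ.* ℕ→ℚ L) {{2L-pos}}
  (subst₂ ℚ._≤_ (sym (ℚₚ.*-zeroˡ (two ℚ.* ℕ→ℚ L)))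
    (solve 3 (λ t x l → t :* (x :* l) := x :* (t :* l)) refl two q (ℕ→ℚ L))
    (ℚₚ.≤-trans (ℕ→ℚ-mono-≤ {0} {D} z≤n) D≤))
  where
  open ℚ-Solver.+-*-Solver
  two = ℕ→ℚ 2
  2L-pos : Positive (two ℚ.* ℕ→ℚ L)
  2L-pos = subst Positive (ℕ→ℚ-* 2 L) (ℕ→ℚ-pos (2 * L) (≤-trans 1≤L (m≤m+n L _)))

-- The slack ε = r·m − K·q absorbs the additive constant c once ℓ ≥ N.
rescaled-bound : ∀ (q r : ℚ) (K m c : ℕ) → 1 ≤ m → ℕ→ℚ K ℚ.* q ℚ.< r ℚ.* ℕ→ℚ m →
  ∃[ N ] (∀ ℓ L D D′ → N ≤ ℓ → 1 ≤ L → ℕ→ℚ D ℚ.≤ ℕ→ℚ 2 ℚ.* (q ℚ.* ℕ→ℚ L) →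
    D′ ≤ D * K + c → m * L ≤ ℓ + c → ℕ→ℚ D′ ℚ.≤ ℕ→ℚ 2 ℚ.* (r ℚ.* ℕ→ℚ ℓ))
rescaled-bound q r K m c 1≤m Kq<rm = N , bound
  where
  two = ℕ→ℚ 2
  Kᵣ = ℕ→ℚ K
  mᵣ = ℕ→ℚ m
  cᵣ = ℕ→ℚ c
  ε = r ℚ.* mᵣ ℚ.- Kᵣ ℚ.* q
  0<2ε : 0ℚ ℚ.< two ℚ.* ε
  0<2ε = subst (ℚ._< two ℚ.* ε) (ℚₚ.*-zeroʳ two)
    (ℚₚ.*-monoʳ-<-pos two {{ℕ→ℚ-pos 2 (s≤s z≤n)}}
      (subst (ℚ._< ε) (ℚₚ.+-inverseʳ (Kᵣ ℚ.* q)) (ℚₚ.+-monoˡ-< (ℚ.- (Kᵣ ℚ.* q)) Kq<rm)))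
  B = two ℚ.* (Kᵣ ℚ.* q) ℚ.* cᵣ ℚ.+ mᵣ ℚ.* cᵣ
  N = proj₁ (archimedean 0<2ε B)
  bound : ∀ ℓ L D D′ → N ≤ ℓ → 1 ≤ L → ℕ→ℚ D ℚ.≤ two ℚ.* (q ℚ.* ℕ→ℚ L) →
    D′ ≤ D * K + c → m * L ≤ ℓ + c → ℕ→ℚ D′ ℚ.≤ two ℚ.* (r ℚ.* ℕ→ℚ ℓ)
  bound ℓ L D D′ N≤ℓ 1≤L D≤2qL D′≤DK+c mL≤ℓ+c = ℚₚ.*-cancelˡ-≤-pos mᵣ {{ℕ→ℚ-pos m 1≤m}} (begin
    mᵣ ℚ.* ℕ→ℚ D′                            ≤⟨ ℚₚ.*-monoˡ-≤-nonNeg mᵣ {{ℕ→ℚ-nonNeg m}} D′≤ ⟩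
    mᵣ ℚ.* (Dᵣ ℚ.* Kᵣ ℚ.+ cᵣ)                 ≤⟨ ℚₚ.*-monoˡ-≤-nonNeg mᵣ {{ℕ→ℚ-nonNeg m}}
                                                  (ℚₚ.+-monoˡ-≤ cᵣ (ℚₚ.*-monoʳ-≤-nonNeg Kᵣ {{ℕ→ℚ-nonNeg K}} D≤2qL)) ⟩
    mᵣ ℚ.* (two ℚ.* (q ℚ.* Lᵣ) ℚ.* Kᵣ ℚ.+ cᵣ) ≡⟨ solve 6 (λ m t x l k c → m :* ((t :* (x :* l)) :* k :+ c) :=
                                                    (t :* (k :* x)) :* (m :* l) :+ m :* c) refl mᵣ two q Lᵣ Kᵣ cᵣ ⟩
    X ℚ.* (mᵣ ℚ.* Lᵣ) ℚ.+ mᵣ ℚ.* cᵣ            ≤⟨ ℚₚ.+-monoˡ-≤ (mᵣ ℚ.* cᵣ)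
                                                  (ℚₚ.*-monoˡ-≤-nonNeg X {{X-nonNeg}} mL≤) ⟩
    X ℚ.* (ℓᵣ ℚ.+ cᵣ) ℚ.+ mᵣ ℚ.* cᵣ            ≡⟨ solve 4 (λ x l c m → x :* (l :+ c) :+ m :* c :=
                                                    x :* l :+ (x :* c :+ m :* c))
                                                  refl X ℓᵣ cᵣ mᵣ ⟩
    X ℚ.* ℓᵣ ℚ.+ B                            ≤⟨ ℚₚ.+-monoʳ-≤ (X ℚ.* ℓᵣ) (ℚₚ.≤-trans (proj₂ (archimedean 0<2ε B))
                                                  (ℚₚ.*-monoˡ-≤-nonNeg (two ℚ.* ε) {{ℚ.nonNegative (ℚₚ.<⇒≤ 0<2ε)}}
                                                    (ℕ→ℚ-mono-≤ N≤ℓ))) ⟩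
    X ℚ.* ℓᵣ ℚ.+ two ℚ.* ε ℚ.* ℓᵣ             ≡⟨ solve 6 (λ t k x l r m →
                                                    (t :* (k :* x)) :* l :+ (t :* (r :* m :- k :* x)) :* l :=
                                                    m :* (t :* (r :* l))) refl two Kᵣ q ℓᵣ r mᵣ ⟩
    mᵣ ℚ.* (two ℚ.* (r ℚ.* ℓᵣ))               ∎)
    where
    open ℚₚ.≤-Reasoning
    open ℚ-Solver.+-*-Solver
    Lᵣ = ℕ→ℚ L
    ℓᵣ = ℕ→ℚ ℓ
    Dᵣ = ℕ→ℚ D
    X = two ℚ.* (Kᵣ ℚ.* q)
    X-nonNeg : NonNegative X
    X-nonNeg = ℚ.nonNegative (subst (ℚ._≤ X) (ℚₚ.*-zeroʳ two) (ℚₚ.*-monoˡ-≤-nonNeg two {{ℕ→ℚ-nonNeg 2}}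
      (subst (ℚ._≤ Kᵣ ℚ.* q) (ℚₚ.*-zeroʳ Kᵣ)
        (ℚₚ.*-monoˡ-≤-nonNeg Kᵣ {{ℕ→ℚ-nonNeg K}} (nonNeg-of-≤-scaled D L 1≤L D≤2qL)))))
    D′≤ : ℕ→ℚ D′ ℚ.≤ Dᵣ ℚ.* Kᵣ ℚ.+ cᵣ
    D′≤ = subst (ℕ→ℚ D′ ℚ.≤_) (trans (ℕ→ℚ-+ (D * K) c) (cong (ℚ._+ cᵣ) (ℕ→ℚ-* D K))) (ℕ→ℚ-mono-≤ D′≤DK+c)
    mL≤ : mᵣ ℚ.* Lᵣ ℚ.≤ ℓᵣ ℚ.+ cᵣ
    mL≤ = subst₂ ℚ._≤_ (ℕ→ℚ-* m L) (ℕ→ℚ-+ ℓ c) (ℕ→ℚ-mono-≤ mL≤ℓ+c)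

crossing : ∀ {P : ℕ → Set} → Decidable P → P 0 → ∀ n → ¬ P n → ∃[ a ] (P a × ¬ P (suc a))
crossing P? P0 zero ¬Pn = ⊥-elim (¬Pn P0)
crossing P? P0 (suc n) ¬Psn with P? n
... | yes Pn = n , Pn , ¬Psn
... | no ¬Pn = crossing P? P0 n ¬Pn

margin-cancel : ∀ {ℓ j j′ W W′ d c} → (ℓ + j) + (ℓ + j′) ≤ (W + W) + d → W ≤ W′ + (j + j′) → j + j′ ≤ c →
  ℓ + ℓ ≤ (W′ + W′) + (d + c)
margin-cancel {ℓ} {j} {j′} {W} {W′} {d} {c} images≤ W≤ J≤c = +-cancelʳ-≤ J _ _ (begin
  ℓ + ℓ + J                        ≡⟨ solve 3 (λ l a b → l :+ l :+ (a :+ b) := (l :+ a) :+ (l :+ b)) refl ℓ j j′ ⟩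
  (ℓ + j) + (ℓ + j′)               ≤⟨ images≤ ⟩
  (W + W) + d                      ≤⟨ +-monoˡ-≤ d (+-mono-≤ W≤ W≤) ⟩
  (W′ + J) + (W′ + J) + d          ≡⟨ solve 3 (λ w x d → (w :+ x) :+ (w :+ x) :+ d := (w :+ w) :+ (d :+ x) :+ x)
                                        refl W′ J d ⟩
  (W′ + W′) + (d + J) + J          ≤⟨ +-monoˡ-≤ J (+-monoʳ-≤ (W′ + W′) (+-monoʳ-≤ d J≤c)) ⟩
  (W′ + W′) + (d + c) + J          ∎)
  where
  open ≤-Reasoning
  open +-*-Solver
  J = j + j′

record SlowlyIncreasing (p : ℕ → ℕ) (s : ℕ) : Set where
  field
    start     : p 0 ≡ 0
    unbounded : ∀ j → j ≤ p j
    step      : ∀ j → p (suc j) ≤ p j + s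

module _ {p q : ℕ → ℕ} {s δ : ℕ} where
  open SlowlyIncreasing

  ≤-after-crossing : SlowlyIncreasing p s → (∀ j → q j ≤ p j + δ) →
    ∀ {a k} → k < p (suc a) ⊎ k < q (suc a) → k ≤ p a + (s + δ)
  ≤-after-crossing P q≤p+δ {a} (inj₁ k<p) = ≤-trans (<⇒≤ k<p) (≤-trans (step P a) (+-monoʳ-≤ (p a) (m≤m+n s δ)))
  ≤-after-crossing P q≤p+δ {a} {k} (inj₂ k<q) = begin
    k                 ≤⟨ <⇒≤ k<q ⟩
    q (suc a)         ≤⟨ q≤p+δ (suc a) ⟩
    p (suc a) + δ     ≤⟨ +-monoˡ-≤ δ (step P a) ⟩
    p a + s + δ       ≡⟨ +-assoc (p a) s δ ⟩
    p a + (s + δ)     ∎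
    where open ≤-Reasoning

  ≤-before-crossing : SlowlyIncreasing p s → (∀ j → p j ≤ q j + δ) →
    ∀ {b T} → p b < T ⊎ q b < T → p (suc b) ≤ T + (s + δ)
  ≤-before-crossing P p≤q+δ {b} {T} below = begin
    p (suc b)         ≤⟨ step P b ⟩
    p b + s           ≤⟨ +-monoˡ-≤ s (pb≤ below) ⟩
    T + δ + s         ≡⟨ trans (+-assoc T δ s) (cong (T +_) (+-comm δ s)) ⟩
    T + (s + δ)       ∎
    where
    open ≤-Reasoning
    pb≤ : p b < T ⊎ q b < T → p b ≤ T + δ
    pb≤ (inj₁ p<T) = ≤-trans (<⇒≤ p<T) (m≤m+n T δ)
    pb≤ (inj₂ q<T) = ≤-trans (p≤q+δ b) (+-monoˡ-≤ δ (<⇒≤ q<T))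

module _ {p q : ℕ → ℕ} {s δ : ℕ} (P : SlowlyIncreasing p s) (Q : SlowlyIncreasing q s)
         (p≤q+δ : ∀ j → p j ≤ q j + δ) (q≤p+δ : ∀ j → q j ≤ p j + δ) where
  open SlowlyIncreasing

  common-index-below : ∀ k → ∃[ a ] (p a ≤ k × q a ≤ k × k ≤ p a + (s + δ) × k ≤ q a + (s + δ))
  common-index-below k with crossing (λ j → (p j ≤? k) ×-dec (q j ≤? k))
                                     (subst (_≤ k) (sym (start P)) z≤n , subst (_≤ k) (sym (start Q)) z≤n)
                                     (suc k) (λ (p≤k , _) → <⇒≱ (unbounded P (suc k)) p≤k)
  ... | a , (pa≤k , qa≤k) , ¬both = a , pa≤k , qa≤k ,
    ≤-after-crossing P q≤p+δ crossed , ≤-after-crossing Q p≤q+δ (swap crossed)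
    where
    crossed : k < p (suc a) ⊎ k < q (suc a)
    crossed with p (suc a) ≤? k | q (suc a) ≤? k
    ... | no p≰k | _      = inj₁ (≰⇒> p≰k)
    ... | yes _  | no q≰k = inj₂ (≰⇒> q≰k)
    ... | yes p≤k | yes q≤k = ⊥-elim (¬both (p≤k , q≤k))

  common-index-above : ∀ T → 1 ≤ T → ∃[ b ] (T ≤ p b × T ≤ q b × p b ≤ T + (s + δ) × q b ≤ T + (s + δ))
  common-index-above T 1≤T with crossing (λ j → (p j <? T) ⊎-dec (q j <? T))
                                         (inj₁ (subst (_< T) (sym (start P)) 1≤T))
                                         T [ (λ p<T → <⇒≱ p<T (unbounded P T)) , (λ q<T → <⇒≱ q<T (unbounded Q T)) ]
  ... | b , below , ¬below = suc b , ≮⇒≥ (¬below ∘ inj₁) , ≮⇒≥ (¬below ∘ inj₂) ,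
    ≤-before-crossing P p≤q+δ below , ≤-before-crossing Q q≤p+δ (swap below)

module _ {A : Set} where

  ⊆-++-split : ∀ {w : List A} xs ys → w ⊆ xs ++ ys → ∃[ w₁ ] ∃[ w₂ ] (w ≡ w₁ ++ w₂ × w₁ ⊆ xs × w₂ ⊆ ys)
  ⊆-++-split [] ys w⊆ = [] , _ , refl , [] , w⊆
  ⊆-++-split (x ∷ xs) ys (.x ∷ʳ w⊆) with ⊆-++-split xs ys w⊆
  ... | w₁ , w₂ , refl , w₁⊆ , w₂⊆ = w₁ , w₂ , refl , x ∷ʳ w₁⊆ , w₂⊆
  ⊆-++-split (x ∷ xs) ys (refl ∷ w⊆) with ⊆-++-split xs ys w⊆
  ... | w₁ , w₂ , refl , w₁⊆ , w₂⊆ = x ∷ w₁ , w₂ , refl , refl ∷ w₁⊆ , w₂⊆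

  ⊆-trim : ∀ {w : List A} p v s → w ⊆ p ++ v ++ s →
    ∃[ w′ ] (w′ ⊆ v × w′ ⊆ w × length w ≤ length w′ + (length p + length s))
  ⊆-trim p v s w⊆ with ⊆-++-split p (v ++ s) w⊆
  ... | w₁ , _ , refl , w₁⊆p , w₂₃⊆ with ⊆-++-split v s w₂₃⊆
  ... | w₂ , w₃ , refl , w₂⊆v , w₃⊆s = w₂ , w₂⊆v , ++⁺ˡ w₁ (++⁺ʳ w₃ ⊆-refl) , (begin
    length (w₁ ++ w₂ ++ w₃)             ≡⟨ length-++ w₁ ⟩
    length w₁ + length (w₂ ++ w₃)       ≡⟨ cong (length w₁ +_) (length-++ w₂) ⟩
    length w₁ + (length w₂ + length w₃) ≤⟨ +-mono-≤ (length-mono-≤ w₁⊆p)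
                                             (+-monoʳ-≤ (length w₂) (length-mono-≤ w₃⊆s)) ⟩
    length p + (length w₂ + length s)   ≡⟨ x∙yz≈y∙xz (length p) (length w₂) (length s) ⟩
    length w₂ + (length p + length s)   ∎)
    where open ≤-Reasoning

  ⊆-common-infix : ∀ {w : List A} p v s p′ v′ s′ → w ⊆ p ++ v ++ s → w ⊆ p′ ++ v′ ++ s′ →
    ∃[ w′ ] (w′ ⊆ v × w′ ⊆ v′ × length w ≤ length w′ + ((length p + length s) + (length p′ + length s′)))
  ⊆-common-infix {w} p v s p′ v′ s′ w⊆ w⊆′ with ⊆-trim p v s w⊆
  ... | w₁ , w₁⊆v , w₁⊆w , w≤ with ⊆-trim p′ v′ s′ (⊆-trans w₁⊆w w⊆′)
  ... | w₂ , w₂⊆v′ , w₂⊆w₁ , w₁≤ = w₂ , ⊆-trans w₂⊆w₁ w₁⊆v , w₂⊆v′ , (begin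
    length w                          ≤⟨ w≤ ⟩
    length w₁ + j                     ≤⟨ +-monoˡ-≤ j w₁≤ ⟩
    length w₂ + j′ + j                ≡⟨ +-assoc (length w₂) j′ j ⟩
    length w₂ + (j′ + j)              ≡⟨ cong (length w₂ +_) (+-comm j′ j) ⟩
    length w₂ + (j + j′)              ∎)
    where
    open ≤-Reasoning
    j  = length p + length s
    j′ = length p′ + length s′

  length-++₃ : ∀ (p m s : List A) → length (p ++ m ++ s) ≡ length p + (length m + length s)
  length-++₃ p m s = trans (length-++ p) (cong (length p +_) (length-++ m))

  data EditScript : List A → List A → Set where
    []   : EditScript [] []
    del  : ∀ a {u v} → EditScript u v → EditScript (a ∷ u) v
    ins  : ∀ a {u v} → EditScript u v → EditScript u (a ∷ v)
    keep : ∀ a {u v} → EditScript u v → EditScript (a ∷ u) (a ∷ v)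

  indels : ∀ {u v} → EditScript u v → ℕ
  indels []         = 0
  indels (del _ α)  = suc (indels α)
  indels (ins _ α)  = suc (indels α)
  indels (keep _ α) = indels α

  editScript : ∀ {w u v : List A} → w ⊆ u → w ⊆ v →
    Σ (EditScript u v) λ α → indels α + (length w + length w) ≡ length u + length v
  editScript (y ∷ʳ w⊆u) w⊆v with editScript w⊆u w⊆v
  ... | α , eq = del y α , cong suc eq
  editScript [] [] = [] , refl
  editScript {u = u} [] (y ∷ʳ w⊆v) with editScript [] w⊆v
  ... | α , eq = ins y α , trans (cong suc eq) (sym (+-suc (length u) _))
  editScript {u = u} (refl ∷ w⊆u) (y ∷ʳ w⊆v) with editScript (refl ∷ w⊆u) w⊆v
  ... | α , eq = ins y α , trans (cong suc eq) (sym (+-suc (length u) _))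
  editScript {w = x ∷ w} {u = _ ∷ u} {v = _ ∷ v} (refl ∷ w⊆u) (refl ∷ w⊆v) with editScript w⊆u w⊆v
  ... | α , eq = keep x α , (begin
    indels α + (suc (length w) + suc (length w)) ≡⟨ cong (indels α +_) (cong suc (+-suc (length w) (length w))) ⟩
    indels α + (2 + (length w + length w))       ≡⟨ x∙yz≈y∙xz (indels α) 2 _ ⟩
    2 + (indels α + (length w + length w))       ≡⟨ cong (2 +_) eq ⟩
    2 + (length u + length v)                    ≡⟨ cong suc (sym (+-suc (length u) (length v))) ⟩
    suc (length u) + suc (length v)              ∎)
    where open ≡-Reasoning

  prefixL : (n : ℕ) → List A → Maybe (Vec A n)
  prefixL zero    _       = just Vec.[]
  prefixL (suc n) []      = nothing
  prefixL (suc n) (a ∷ u) = Maybe.map (a Vec.∷_) (prefixL n u)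

  prefixL-++ : ∀ n p r r′ → n ≤ length p → prefixL n (p ++ r) ≡ prefixL n (p ++ r′)
  prefixL-++ zero    p       r r′ _         = refl
  prefixL-++ (suc n) (a ∷ p) r r′ (s≤s n≤p) = cong (Maybe.map (a Vec.∷_)) (prefixL-++ n p r r′ n≤p)

  prefixL-++-just : ∀ n l s {w} → prefixL n l ≡ just w → prefixL n (l ++ s) ≡ just w
  prefixL-++-just zero    l       s eq = eq
  prefixL-++-just (suc n) (a ∷ l) s eq with prefixL n l in e
  ... | just _ rewrite prefixL-++-just n l s e = eq

  prefixL-just⇒≤ : ∀ n l {w} → prefixL n l ≡ just w → n ≤ length l
  prefixL-just⇒≤ zero    l       eq = z≤n
  prefixL-just⇒≤ (suc n) (a ∷ l) eq with prefixL n l in e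
  ... | just _ = s≤s (prefixL-just⇒≤ n l e)

  prefixL-nothing⇒< : ∀ n l → prefixL n l ≡ nothing → length l < n
  prefixL-nothing⇒< (suc n) []      eq = s≤s z≤n
  prefixL-nothing⇒< (suc n) (a ∷ l) eq with prefixL n l in e
  ... | nothing = s≤s (prefixL-nothing⇒< n l e)

  prefixL-short : ∀ n l → length l < n → prefixL n l ≡ nothing
  prefixL-short (suc n) []      _          = refl
  prefixL-short (suc n) (a ∷ l) (s≤s l<n) rewrite prefixL-short n l l<n = refl

  segment : (ℕ → A) → ℕ → ℕ → List A
  segment x k zero    = []
  segment x k (suc n) = x k ∷ segment x (suc k) n

  length-segment : ∀ x k n → length (segment x k n) ≡ n
  length-segment x k zero    = refl
  length-segment x k (suc n) = cong suc (length-segment x (suc k) n)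

  factor≡segment : ∀ x k n → factor x k n ≡ segment x k n
  factor≡segment x k n = trans (map-upTo (λ i → x (k + i)) n) (applyUpTo≡segment k (λ _ → refl) n)
    where
    applyUpTo≡segment : ∀ {g} k → (∀ i → g i ≡ x (k + i)) → ∀ n → applyUpTo g n ≡ segment x k n
    applyUpTo≡segment k g≗ zero    = refl
    applyUpTo≡segment k g≗ (suc n) = cong₂ _∷_ (trans (g≗ 0) (cong x (+-identityʳ k)))
      (applyUpTo≡segment (suc k) (λ i → trans (g≗ (suc i)) (cong x (+-suc k i))) n)

  SegmentsWithin : (ℕ → A) → (ℕ → A) → ℕ → ℕ → ℚ → Set
  SegmentsWithin x y k ℓ s = ∃[ w ] (w ⊆ segment x k ℓ × w ⊆ segment y k ℓ ×
    ℕ→ℚ ((ℓ + ℓ) ∸ (length w + length w)) ℚ.≤ ℕ→ℚ 2 ℚ.* s)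

  dL≤-factor⇔ : ∀ x y k ℓ {s} → dL≤ (factor x k ℓ) (factor y k ℓ) s ⇔ SegmentsWithin x y k ℓ s
  dL≤-factor⇔ x y k ℓ {s} = mk⇔
    (move (factor≡segment x k ℓ) (factor≡segment y k ℓ) lengths)
    (move (sym (factor≡segment x k ℓ)) (sym (factor≡segment y k ℓ)) (sym lengths))
    where
    length-factor : ∀ z → length (factor z k ℓ) ≡ ℓ
    length-factor z = trans (cong length (factor≡segment z k ℓ)) (length-segment z k ℓ)
    lengths : length (factor x k ℓ) + length (factor y k ℓ) ≡ ℓ + ℓ
    lengths = cong₂ _+_ (length-factor x) (length-factor y)
    move : ∀ {u v u′ v′ n n′} → u ≡ u′ → v ≡ v′ → n ≡ n′ →
      ∃[ w ] (w ⊆ u × w ⊆ v × ℕ→ℚ (n ∸ (length w + length w)) ℚ.≤ ℕ→ℚ 2 ℚ.* s) →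
      ∃[ w ] (w ⊆ u′ × w ⊆ v′ × ℕ→ℚ (n′ ∸ (length w + length w)) ℚ.≤ ℕ→ℚ 2 ℚ.* s)
    move refl refl refl within = within

  segment-+ : ∀ x k m n → segment x k (m + n) ≡ segment x k m ++ segment x (k + m) n
  segment-+ x k zero    n = cong (λ i → segment x i n) (sym (+-identityʳ k))
  segment-+ x k (suc m) n = cong (x k ∷_)
    (trans (segment-+ x (suc k) m n) (cong (λ i → segment x (suc k) m ++ segment x i n) (sym (+-suc k m))))

  segment-+₃ : ∀ x k a b c → segment x k (a + (b + c)) ≡ segment x k a ++ segment x (k + a) b ++ segment x (k + a + b) c
  segment-+₃ x k a b c = trans (segment-+ x k a (b + c)) (cong (segment x k a ++_) (segment-+ x (k + a) b c))

  prefixL-segment : ∀ x k {n ℓ} → n ≤ ℓ → prefixL n (segment x k ℓ) ≡ just (Vec.tabulate (λ i → x (k + toℕ i)))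
  prefixL-segment x k {zero}  _         = refl
  prefixL-segment x k {suc n} (s≤s n≤ℓ) rewrite prefixL-segment x (suc k) n≤ℓ =
    cong just (cong₂ Vec._∷_ (cong x (sym (+-identityʳ k))) (Vecₚ.tabulate-cong (λ i → cong x (sym (+-suc k (toℕ i))))))

  segment-infix : ∀ x s L k ℓ → s ≤ k → k + ℓ ≤ s + L →
    ∃[ p ] ∃[ r ] (segment x s L ≡ p ++ segment x k ℓ ++ r × length p ≡ k ∸ s × length p + (ℓ + length r) ≡ L)
  segment-infix x s L k ℓ s≤k kℓ≤sL =
    segment x s d₁ , segment x (k + ℓ) d₂ , split , length-segment x s d₁ ,
    trans (cong₂ (λ a b → a + (ℓ + b)) (length-segment x s d₁) (length-segment x (k + ℓ) d₂)) (sym L≡)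
    where
    d₁ = k ∸ s
    d₂ = (s + L) ∸ (k + ℓ)
    L≡ : L ≡ d₁ + (ℓ + d₂)
    L≡ = +-cancelˡ-≡ s L _ (begin
      s + L               ≡⟨ sym (m+[n∸m]≡n kℓ≤sL) ⟩
      k + ℓ + d₂          ≡⟨ cong (λ z → z + ℓ + d₂) (sym (m+[n∸m]≡n s≤k)) ⟩
      s + d₁ + ℓ + d₂     ≡⟨ solve 4 (λ a b c d → a :+ b :+ c :+ d := a :+ (b :+ (c :+ d))) refl s d₁ ℓ d₂ ⟩
      s + (d₁ + (ℓ + d₂)) ∎)
      where
      open ≡-Reasoning
      open +-*-Solver
    split : segment x s L ≡ segment x s d₁ ++ segment x k ℓ ++ segment x (k + ℓ) d₂
    split = begin
      segment x s L                                           ≡⟨ cong (segment x s) L≡ ⟩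
      segment x s (d₁ + (ℓ + d₂))                             ≡⟨ segment-+ x s d₁ (ℓ + d₂) ⟩
      segment x s d₁ ++ segment x (s + d₁) (ℓ + d₂)           ≡⟨ cong (λ i → segment x s d₁ ++ segment x i (ℓ + d₂))
                                                                    (m+[n∸m]≡n s≤k) ⟩
      segment x s d₁ ++ segment x k (ℓ + d₂)                  ≡⟨ cong (segment x s d₁ ++_) (segment-+ x k ℓ d₂) ⟩
      segment x s d₁ ++ segment x k ℓ ++ segment x (k + ℓ) d₂ ∎
      where open ≡-Reasoning

  lookup? : List A → ℕ → Maybe A
  lookup? []       _       = nothing
  lookup? (a ∷ as) zero    = just a
  lookup? (a ∷ as) (suc i) = lookup? as i

  lookup?-++ˡ : ∀ xs ys {i} → i < length xs → lookup? (xs ++ ys) i ≡ lookup? xs i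
  lookup?-++ˡ (a ∷ xs) ys {zero}  _         = refl
  lookup?-++ˡ (a ∷ xs) ys {suc i} (s≤s i<n) = lookup?-++ˡ xs ys i<n

  lookup?-++ʳ : ∀ xs ys i → lookup? (xs ++ ys) (length xs + i) ≡ lookup? ys i
  lookup?-++ʳ []       ys i = refl
  lookup?-++ʳ (a ∷ xs) ys i = lookup?-++ʳ xs ys i

  ≡segment : ∀ x k (zs : List A) → (∀ i → i < length zs → lookup? zs i ≡ just (x (k + i))) →
    zs ≡ segment x k (length zs)
  ≡segment x k []       _      = refl
  ≡segment x k (z ∷ zs) lookup≡ = cong₂ _∷_
    (just-injective (trans (lookup≡ 0 (s≤s z≤n)) (cong (just ∘ x) (+-identityʳ k))))
    (≡segment x (suc k) zs (λ i i<n → trans (lookup≡ (suc i) (s≤s i<n)) (cong (just ∘ x) (+-suc k i))))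

  prepend : List A → (ℕ → A) → ℕ → A
  prepend []       h i       = h i
  prepend (a ∷ as) h zero    = a
  prepend (a ∷ as) h (suc i) = prepend as h i

  lookup?-prepend : ∀ {h} xs ys → (∀ i → i < length ys → lookup? ys i ≡ just (h i)) →
    ∀ i → i < length (xs ++ ys) → lookup? (xs ++ ys) i ≡ just (prepend xs h i)
  lookup?-prepend []       ys ys≗ i       i<n       = ys≗ i i<n
  lookup?-prepend (a ∷ xs) ys ys≗ zero    _         = refl
  lookup?-prepend (a ∷ xs) ys ys≗ (suc i) (s≤s i<n) = lookup?-prepend xs ys ys≗ i i<n

module DillMap {A : Set} {t : ℕ} (f : Vec A (suc t) → List⁺ A) {M : ℕ}
               (f-bounded : ∀ u → List⁺.length (f u) ≤ M) where
  open Dill f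

  θ : ℕ
  θ = suc t

  fstarL : List A → List A
  fstarL []      = []
  fstarL (a ∷ u) = maybe (λ w → toList (f w) ++ fstarL u) [] (prefixL θ (a ∷ u))

  prefix≡prefixL : ∀ {ℓ} n (v : Vec A ℓ) → prefix n v ≡ prefixL n (Vec.toList v)
  prefix≡prefixL zero    v            = refl
  prefix≡prefixL (suc n) Vec.[]       = refl
  prefix≡prefixL (suc n) (a Vec.∷ v) = cong (Maybe.map (a Vec.∷_)) (prefix≡prefixL n v)

  fstar≡fstarL : ∀ {ℓ} (v : Vec A ℓ) → fstar v ≡ fstarL (Vec.toList v)
  fstar≡fstarL Vec.[]       = refl
  fstar≡fstarL (a Vec.∷ v) rewrite prefix≡prefixL t v | fstar≡fstarL v = refl

  fstarL-short : ∀ l → length l ≤ t → fstarL l ≡ []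
  fstarL-short []      _          = refl
  fstarL-short (a ∷ l) l<t rewrite prefixL-short t l l<t = refl

  fstarL-∷-just : ∀ a l {w} → prefixL θ (a ∷ l) ≡ just w → fstarL (a ∷ l) ≡ toList (f w) ++ fstarL l
  fstarL-∷-just a l eq with prefixL t l
  fstarL-∷-just a l refl | just _ = refl

  fstarL-∷-nothing : ∀ a l → prefixL t l ≡ nothing → fstarL (a ∷ l) ≡ fstarL l
  fstarL-∷-nothing a l eq with prefixL t l in e
  fstarL-∷-nothing a l refl | nothing = sym (fstarL-short l (<⇒≤ (prefixL-nothing⇒< t l e)))

  fstarL-∷ : ∀ a l → ∃[ G ] (fstarL (a ∷ l) ≡ G ++ fstarL l × length G ≤ M)
  fstarL-∷ a l = by-cases (prefixL t l) refl
    where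
    by-cases : ∀ p → prefixL t l ≡ p → ∃[ G ] (fstarL (a ∷ l) ≡ G ++ fstarL l × length G ≤ M)
    by-cases (just w) e = toList (f (a Vec.∷ w)) , fstarL-∷-just a l (cong (Maybe.map (a Vec.∷_)) e) , f-bounded (a Vec.∷ w)
    by-cases nothing  e = [] , fstarL-∷-nothing a l e , z≤n

  fstarL-∷-agree : ∀ a {u v} → prefixL t u ≡ prefixL t v →
    ∃[ B ] (fstarL (a ∷ u) ≡ B ++ fstarL u × fstarL (a ∷ v) ≡ B ++ fstarL v)
  fstarL-∷-agree a {u} {v} agree = by-cases (prefixL t u) refl
    where
    by-cases : ∀ p → prefixL t u ≡ p →
      ∃[ B ] (fstarL (a ∷ u) ≡ B ++ fstarL u × fstarL (a ∷ v) ≡ B ++ fstarL v)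
    by-cases (just w) e = toList (f (a Vec.∷ w)) , fstarL-∷-just a u (cong (Maybe.map (a Vec.∷_)) e) ,
      fstarL-∷-just a v (cong (Maybe.map (a Vec.∷_)) (trans (sym agree) e))
    by-cases nothing  e = [] , fstarL-∷-nothing a u e , fstarL-∷-nothing a v (trans (sym agree) e)

  length-fstarL : ∀ l → length (fstarL l) ≤ M * (length l ∸ t)
  length-fstarL []      = z≤n
  length-fstarL (a ∷ l) with prefixL t l in e
  ... | nothing = z≤n
  ... | just w  = begin
    length (toList (f (a Vec.∷ w)) ++ fstarL l)          ≡⟨ length-++ (toList (f (a Vec.∷ w))) ⟩
    List⁺.length (f (a Vec.∷ w)) + length (fstarL l)     ≤⟨ +-mono-≤ (f-bounded (a Vec.∷ w)) (length-fstarL l) ⟩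
    M + M * (length l ∸ t)                               ≡⟨ sym (*-suc M _) ⟩
    M * suc (length l ∸ t)                               ≡⟨ cong (M *_) (sym (+-∸-assoc 1 (prefixL-just⇒≤ t l e))) ⟩
    M * (suc (length l) ∸ t)                             ∎
    where open ≤-Reasoning

  fstarL-++ˡ : ∀ p r → ∃[ G ] (fstarL (p ++ r) ≡ G ++ fstarL r × length G ≤ M * length p)
  fstarL-++ˡ []      r = [] , refl , z≤n
  fstarL-++ˡ (a ∷ p) r with fstarL-∷ a (p ++ r) | fstarL-++ˡ p r
  ... | G₁ , e₁ , G₁≤ | G₂ , e₂ , G₂≤ =
    G₁ ++ G₂ , trans e₁ (trans (cong (G₁ ++_) e₂) (sym (++-assoc G₁ G₂ (fstarL r)))) ,
    ≤-trans (≤-reflexive (length-++ G₁)) (≤-trans (+-mono-≤ G₁≤ G₂≤) (≤-reflexive (sym (*-suc M (length p)))))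

  fstarL-++ʳ : ∀ r s → ∃[ G ] (fstarL (r ++ s) ≡ fstarL r ++ G × length G ≤ M * length s)
  fstarL-++ʳ [] s = fstarL s , refl , ≤-trans (length-fstarL s) (*-monoʳ-≤ M (m∸n≤m (length s) t))
  fstarL-++ʳ (a ∷ r) s with prefixL t r in e
  ... | just w rewrite prefixL-++-just t r s e with fstarL-++ʳ r s
  ...   | G , eq , G≤ = G , trans (cong (B ++_) eq) (sym (++-assoc B (fstarL r) G)) , G≤
    where B = toList (f (a Vec.∷ w))
  fstarL-++ʳ (a ∷ r) s | nothing =
    fstarL (a ∷ r ++ s) , refl , ≤-trans (length-fstarL (a ∷ r ++ s)) (*-monoʳ-≤ M (begin
      suc (length (r ++ s)) ∸ t                  ≡⟨ cong (λ n → suc n ∸ t) (length-++ r) ⟩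
      (suc (length r) + length s) ∸ t            ≤⟨ ∸-monoʳ-≤ (suc (length r) + length s) (prefixL-nothing⇒< t r e) ⟩
      (suc (length r) + length s) ∸ suc (length r) ≡⟨ m+n∸m≡n (suc (length r)) (length s) ⟩
      length s                                   ∎))
    where open ≤-Reasoning

  length-fstarL-infix : ∀ p m s → length (fstarL m) ≤ length (fstarL (p ++ m ++ s)) ×
    length (fstarL (p ++ m ++ s)) ≤ M * length p + length (fstarL m) + M * length s
  length-fstarL-infix p m s with fstarL-++ˡ p (m ++ s) | fstarL-++ʳ m s
  ... | G₁ , e₁ , G₁≤ | G₂ , e₂ , G₂≤ =
    ≤-trans (≤-trans (m≤m+n _ (length G₂)) (m≤n+m _ (length G₁))) (≤-reflexive (sym split)) ,
    (begin
      length (fstarL (p ++ m ++ s))                  ≡⟨ split ⟩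
      length G₁ + (length (fstarL m) + length G₂)    ≤⟨ +-mono-≤ G₁≤ (+-monoʳ-≤ (length (fstarL m)) G₂≤) ⟩
      M * length p + (length (fstarL m) + M * length s) ≡⟨ sym (+-assoc (M * length p) _ _) ⟩
      M * length p + length (fstarL m) + M * length s ∎)
    where
    open ≤-Reasoning
    split : length (fstarL (p ++ m ++ s)) ≡ length G₁ + (length (fstarL m) + length G₂)
    split = trans (cong length e₁) (trans (length-++ G₁)
              (cong (length G₁ +_) (trans (cong length e₂) (length-++ (fstarL m)))))

  K : ℕ
  K = M + (t * M + t * M)

  -- Images are built from right to left. An indel costs its own block (≤ M), and each
  -- of the t windows starting to its left that still contain it may give different
  -- blocks on the two sides (≤ 2M); credit counts those windows not yet added.
  credit : ∀ {u v : List A} → EditScript u v → ℕ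
  credit []         = 0
  credit (del _ _)  = t
  credit (ins _ _)  = t
  credit (keep _ α) = credit α ∸ 1

  prefixL-agree : ∀ {u v : List A} (α : EditScript u v) s → credit α + s ≤ t → prefixL s u ≡ prefixL s v
  prefixL-agree α          zero    _   = refl
  prefixL-agree []         (suc s) _   = refl
  prefixL-agree (del _ _)  (suc s) le  = ⊥-elim (m+1+n≰m t le)
  prefixL-agree (ins _ _)  (suc s) le  = ⊥-elim (m+1+n≰m t le)
  prefixL-agree (keep a α) (suc s) le  =
    cong (Maybe.map (a Vec.∷_)) (prefixL-agree α s (≤-trans (shift (credit α)) le))
    where
    shift : ∀ c → c + s ≤ (c ∸ 1) + suc s
    shift zero    = n≤1+n s
    shift (suc c) = ≤-reflexive (sym (+-suc c s))

  record ImageMatch (u v : List A) (c n : ℕ) : Set where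
    constructor match
    field
      {common} : List A
      common⊆ˡ : common ⊆ fstarL u
      common⊆ʳ : common ⊆ fstarL v
      bound    : length (fstarL u) + length (fstarL v) + (c * M + c * M) ≤
                   (length common + length common) + n * K

  ImageMatch-sym : ∀ {u v c n} → ImageMatch u v c n → ImageMatch v u c n
  ImageMatch-sym {u} {v} {c} {n} (match {W} W⊆u W⊆v le) =
    match W⊆v W⊆u (subst (λ z → z + (c * M + c * M) ≤ length W + length W + n * K) (+-comm (length (fstarL u)) _) le)

  ImageMatch-del : ∀ a {u v c n} → ImageMatch u v c n → ImageMatch (a ∷ u) v t (suc n)
  ImageMatch-del a {u} {v} {c} {n} (match {W} W⊆u W⊆v le) with fstarL-∷ a u
  ... | G , eq , G≤M = match (subst (W ⊆_) (sym eq) (++⁺ˡ G W⊆u)) W⊆v (begin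
    length (fstarL (a ∷ u)) + V + T  ≡⟨ cong (λ z → length z + V + T) eq ⟩
    length (G ++ fstarL u) + V + T   ≡⟨ cong (λ z → z + V + T) (length-++ G) ⟩
    length G + U + V + T             ≡⟨ solve 4 (λ g a b t → g :+ a :+ b :+ t := (g :+ t) :+ (a :+ b)) refl (length G) U V T ⟩
    (length G + T) + (U + V)         ≤⟨ +-mono-≤ (+-monoˡ-≤ T G≤M) (m≤m+n (U + V) _) ⟩
    (M + T) + (U + V + (c * M + c * M)) ≤⟨ +-monoʳ-≤ (M + T) le ⟩
    (M + T) + (Wₗ + n * K)           ≡⟨ x∙yz≈y∙xz (M + T) Wₗ (n * K) ⟩
    Wₗ + suc n * K                   ∎)
    where
    open ≤-Reasoning
    open +-*-Solver
    U = length (fstarL u)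
    V = length (fstarL v)
    T = t * M + t * M
    Wₗ = length W + length W

  ImageMatch-keep : ∀ a c {u v n} → (c ≡ 0 → prefixL t u ≡ prefixL t v) →
    ImageMatch u v c n → ImageMatch (a ∷ u) (a ∷ v) (c ∸ 1) n
  ImageMatch-keep a zero {u} {v} {n} agree (match {W} W⊆u W⊆v le) with fstarL-∷-agree a (agree refl)
  ... | B , eu , ev =
    match (subst (B ++ W ⊆_) (sym eu) (++⁺ ⊆-refl W⊆u)) (subst (B ++ W ⊆_) (sym ev) (++⁺ ⊆-refl W⊆v)) (begin
    length (fstarL (a ∷ u)) + length (fstarL (a ∷ v)) + 0 ≡⟨ cong₂ (λ x y → length x + length y + 0) eu ev ⟩
    length (B ++ fstarL u) + length (B ++ fstarL v) + 0  ≡⟨ cong₂ (λ x y → x + y + 0) (length-++ B) (length-++ B) ⟩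
    (b + U) + (b + V) + 0                              ≡⟨ solve 3 (λ b u v → (b :+ u) :+ (b :+ v) :+ con 0 :=
                                                            (b :+ b) :+ (u :+ v :+ con 0)) refl b U V ⟩
    (b + b) + (U + V + 0)                              ≤⟨ +-monoʳ-≤ (b + b) le ⟩
    (b + b) + ((Wₗ + Wₗ) + n * K)                      ≡⟨ solve 4 (λ b w n k → (b :+ b) :+ ((w :+ w) :+ n :* k) :=
                                                            ((b :+ w) :+ (b :+ w)) :+ n :* k) refl b Wₗ n K ⟩
    ((b + Wₗ) + (b + Wₗ)) + n * K                      ≡⟨ cong (λ z → z + z + n * K) (sym (length-++ B)) ⟩
    (length (B ++ W) + length (B ++ W)) + n * K        ∎)
    where
    open ≤-Reasoning
    open +-*-Solver
    b = length B
    U = length (fstarL u)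
    V = length (fstarL v)
    Wₗ = length W
  ImageMatch-keep a (suc c) {u} {v} {n} _ (match {W} W⊆u W⊆v le) with fstarL-∷ a u | fstarL-∷ a v
  ... | Gu , eu , Gu≤M | Gv , ev , Gv≤M =
    match (subst (W ⊆_) (sym eu) (++⁺ˡ Gu W⊆u)) (subst (W ⊆_) (sym ev) (++⁺ˡ Gv W⊆v)) (begin
    length (fstarL (a ∷ u)) + length (fstarL (a ∷ v)) + C ≡⟨ cong₂ (λ x y → length x + length y + C) eu ev ⟩
    length (Gu ++ fstarL u) + length (Gv ++ fstarL v) + C ≡⟨ cong₂ (λ x y → x + y + C) (length-++ Gu) (length-++ Gv) ⟩
    (length Gu + U) + (length Gv + V) + C                  ≡⟨ solve 5 (λ g h u v c → (g :+ u) :+ (h :+ v) :+ c :=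
                                                                (g :+ h) :+ (u :+ v :+ c)) refl (length Gu) (length Gv) U V C ⟩
    (length Gu + length Gv) + (U + V + C)                  ≤⟨ +-monoˡ-≤ _ (+-mono-≤ Gu≤M Gv≤M) ⟩
    (M + M) + (U + V + C)                                  ≡⟨ solve 4 (λ m u v c → (m :+ m) :+ (u :+ v :+ (c :+ c)) :=
                                                                u :+ v :+ ((m :+ c) :+ (m :+ c))) refl M U V (c * M) ⟩
    U + V + (suc c * M + suc c * M)                        ≤⟨ le ⟩
    length W + length W + n * K                            ∎)
    where
    open ≤-Reasoning
    open +-*-Solver
    U = length (fstarL u)
    V = length (fstarL v)
    C = c * M + c * M

  editScript-ImageMatch : ∀ {u v : List A} (α : EditScript u v) → ImageMatch u v (credit α) (indels α)
  editScript-ImageMatch []         = match [] [] z≤n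
  editScript-ImageMatch (del a α)  = ImageMatch-del a (editScript-ImageMatch α)
  editScript-ImageMatch (ins a α)  = ImageMatch-sym (ImageMatch-del a (ImageMatch-sym (editScript-ImageMatch α)))
  editScript-ImageMatch (keep a α) = ImageMatch-keep a (credit α)
    (λ c≡0 → prefixL-agree α t (≤-reflexive (cong (_+ t) c≡0)))
    (editScript-ImageMatch α)

  fstarL-common-sublist : ∀ {w u v : List A} → w ⊆ u → w ⊆ v →
    ∃[ W ] (W ⊆ fstarL u × W ⊆ fstarL v × length (fstarL u) + length (fstarL v) ≤
      (length W + length W) + ((length u + length v) ∸ (length w + length w)) * K)
  fstarL-common-sublist {w} {u} {v} w⊆u w⊆v = forget-credit (editScript-ImageMatch α)
    where
    α = proj₁ (editScript w⊆u w⊆v)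
    indels≡ : indels α ≡ (length u + length v) ∸ (length w + length w)
    indels≡ = trans (sym (m+n∸n≡m (indels α) (length w + length w)))
                    (cong (_∸ (length w + length w)) (proj₂ (editScript w⊆u w⊆v)))
    forget-credit : ∀ {c} → ImageMatch u v c (indels α) → ∃[ W ] (W ⊆ fstarL u × W ⊆ fstarL v ×
      length (fstarL u) + length (fstarL v) ≤ (length W + length W) + ((length u + length v) ∸ (length w + length w)) * K)
    forget-credit (match {W} W⊆u W⊆v le) =
      W , W⊆u , W⊆v , ≤-trans (m≤m+n _ _) (subst (λ n → _ ≤ (length W + length W) + n * K) indels≡ le)

  same-ends : ∀ {ℓ} (u v : Vec A ℓ) p m m′ s → θ ≤ length p → θ ≤ length s →
    Vec.toList u ≡ p ++ m ++ s → Vec.toList v ≡ p ++ m′ ++ s → prefix θ u ≡ prefix θ v × suffix θ u ≡ suffix θ v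
  same-ends u v p m m′ s θ≤p θ≤s u≡ v≡ = same-prefix , cong (Maybe.map Vec.reverse) same-reversed-prefix
    where
    reversed : ∀ {ℓ} (z : Vec A ℓ) mid → Vec.toList z ≡ p ++ mid ++ s →
      Vec.toList (Vec.reverse z) ≡ List.reverse s ++ List.reverse (p ++ mid)
    reversed z mid z≡ = trans (Vecₚ.toList-reverse z)
      (trans (cong List.reverse (trans z≡ (sym (++-assoc p mid s)))) (reverse-++ (p ++ mid) s))
    same-prefix : prefix θ u ≡ prefix θ v
    same-prefix = begin
      prefix θ u              ≡⟨ prefix≡prefixL θ u ⟩
      prefixL θ (Vec.toList u) ≡⟨ cong (prefixL θ) u≡ ⟩
      prefixL θ (p ++ m ++ s)  ≡⟨ prefixL-++ θ p (m ++ s) (m′ ++ s) θ≤p ⟩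
      prefixL θ (p ++ m′ ++ s) ≡⟨ cong (prefixL θ) (sym v≡) ⟩
      prefixL θ (Vec.toList v) ≡⟨ sym (prefix≡prefixL θ v) ⟩
      prefix θ v              ∎
      where open ≡-Reasoning
    same-reversed-prefix : prefix θ (Vec.reverse u) ≡ prefix θ (Vec.reverse v)
    same-reversed-prefix = begin
      prefix θ (Vec.reverse u)                               ≡⟨ prefix≡prefixL θ (Vec.reverse u) ⟩
      prefixL θ (Vec.toList (Vec.reverse u))                 ≡⟨ cong (prefixL θ) (reversed u m u≡) ⟩
      prefixL θ (List.reverse s ++ List.reverse (p ++ m))    ≡⟨ prefixL-++ θ (List.reverse s) _ _
                                                                  (≤-trans θ≤s (≤-reflexive (sym (length-reverse s)))) ⟩
      prefixL θ (List.reverse s ++ List.reverse (p ++ m′))   ≡⟨ cong (prefixL θ) (sym (reversed v m′ v≡)) ⟩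
      prefixL θ (Vec.toList (Vec.reverse v))                 ≡⟨ sym (prefix≡prefixL θ (Vec.reverse v)) ⟩
      prefix θ (Vec.reverse v)                               ∎
      where open ≡-Reasoning

  fstarL-middle-invariant : DiamondUniform → ∀ p m m′ s → θ ≤ length p → θ ≤ length s → length m ≡ length m′ →
    length (fstarL (p ++ m ++ s)) ≡ length (fstarL (p ++ m′ ++ s))
  fstarL-middle-invariant DU p m m′ s θ≤p θ≤s m≡m′ = begin
    length (fstarL (p ++ m ++ s))  ≡⟨ cong (length ∘ fstarL) (sym u≡) ⟩
    length (fstarL (Vec.toList u)) ≡⟨ cong length (sym (fstar≡fstarL u)) ⟩
    length (fstar u)               ≡⟨ DU _ θ≤ℓ u v (proj₁ ends) (proj₂ ends) ⟩
    length (fstar v)               ≡⟨ cong length (fstar≡fstarL v) ⟩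
    length (fstarL (Vec.toList v)) ≡⟨ cong (length ∘ fstarL) v≡ ⟩
    length (fstarL (p ++ m′ ++ s)) ∎
    where
    open ≡-Reasoning
    u = Vec.fromList (p ++ m ++ s)
    same-length : length (p ++ m′ ++ s) ≡ length (p ++ m ++ s)
    same-length = trans (length-++₃ p m′ s)
      (trans (cong (λ z → length p + (z + length s)) (sym m≡m′)) (sym (length-++₃ p m s)))
    v = Vec.cast same-length (Vec.fromList (p ++ m′ ++ s))
    u≡ : Vec.toList u ≡ p ++ m ++ s
    u≡ = Vecₚ.toList∘fromList (p ++ m ++ s)
    v≡ : Vec.toList v ≡ p ++ m′ ++ s
    v≡ = trans (Vecₚ.toList-cast same-length _) (Vecₚ.toList∘fromList (p ++ m′ ++ s))
    θ≤ℓ : θ ≤ length (p ++ m ++ s)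
    θ≤ℓ = ≤-trans θ≤p (≤-trans (m≤m+n (length p) _) (≤-reflexive (sym (length-++ p))))
    ends = same-ends u v p m m′ s θ≤p θ≤s u≡ v≡

  blocks : (ℕ → A) → ℕ → ℕ → List A
  blocks x a n = fstarL (segment x a (n + t))

  blocks-zero : ∀ x a → blocks x a 0 ≡ []
  blocks-zero x a = fstarL-short (segment x a t) (≤-reflexive (length-segment x a t))

  blocks-suc : ∀ x a n → blocks x a (suc n) ≡ toList (f (window x a)) ++ blocks x (suc a) n
  blocks-suc x a n = fstarL-∷-just (x a) (segment x (suc a) (n + t)) (prefixL-segment x a (s≤s (m≤n+m t n)))

  blocks-+ : ∀ x a n n′ → blocks x a (n + n′) ≡ blocks x a n ++ blocks x (a + n) n′
  blocks-+ x a zero n′ rewrite blocks-zero x a | +-identityʳ a = refl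
  blocks-+ x a (suc n) n′ rewrite blocks-suc x a (n + n′) | blocks-suc x a n | blocks-+ x (suc a) n n′ | +-suc a n =
    sym (++-assoc (toList (f (window x a))) (blocks x (suc a) n) _)

  length-blocks-≥ : ∀ {m} → (∀ u → m ≤ List⁺.length (f u)) → ∀ x a n → n * m ≤ length (blocks x a n)
  length-blocks-≥ f≥m x a zero    = z≤n
  length-blocks-≥ f≥m x a (suc n) rewrite blocks-suc x a n | length-++ (toList (f (window x a))) {blocks x (suc a) n} =
    +-mono-≤ (f≥m (window x a)) (length-blocks-≥ f≥m x (suc a) n)

  length-blocks-≤ : ∀ x a n → length (blocks x a n) ≤ n * M
  length-blocks-≤ x a zero    rewrite blocks-zero x a = z≤n
  length-blocks-≤ x a (suc n) rewrite blocks-suc x a n | length-++ (toList (f (window x a))) {blocks x (suc a) n} =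
    +-mono-≤ (f-bounded (window x a)) (length-blocks-≤ x (suc a) n)

  n≤length-blocks : ∀ x a n → n ≤ length (blocks x a n)
  n≤length-blocks x a n = ≤-trans (≤-reflexive (sym (*-identityʳ n))) (length-blocks-≥ (λ _ → s≤s z≤n) x a n)

  position : (ℕ → A) → ℕ → ℕ
  position x j = length (blocks x 0 j)

  position-+ : ∀ x a n → position x (a + n) ≡ position x a + length (blocks x a n)
  position-+ x a n = trans (cong length (blocks-+ x 0 a n)) (length-++ (blocks x 0 a))

  position-zero : ∀ x → position x 0 ≡ 0
  position-zero x = cong length (blocks-zero x 0)

  position-suc : ∀ x a → position x (suc a) ≤ position x a + M
  position-suc x a = begin
    position x (suc a)                   ≡⟨ cong (position x) (+-comm 1 a) ⟩
    position x (a + 1)                   ≡⟨ position-+ x a 1 ⟩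
    position x a + length (blocks x a 1) ≤⟨ +-monoʳ-≤ (position x a) (length-blocks-≤ x a 1) ⟩
    position x a + 1 * M                 ≡⟨ cong (position x a +_) (*-identityˡ M) ⟩
    position x a + M                     ∎
    where open ≤-Reasoning

  position-mono : ∀ x {a b} → a ≤ b → position x a ≤ position x b
  position-mono x {a} {b} a≤b = begin
    position x a                                 ≤⟨ m≤m+n _ _ ⟩
    position x a + length (blocks x a (b ∸ a))   ≡⟨ sym (position-+ x a (b ∸ a)) ⟩
    position x (a + (b ∸ a))                     ≡⟨ cong (position x) (m+[n∸m]≡n a≤b) ⟩
    position x b                                 ∎
    where open ≤-Reasoning

  -- `emit` scans a block with a function local to its definition; `walk` names
  -- that function, its body being found by unification in `emit-walk`.
  mutual
    walk : (ℕ → A) → ℕ → ℕ → List⁺ A → ℕ → A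
    walk x j k = _

    emit-walk : ∀ x j k i → emit x j i (suc k) ≡ walk x j k (f (window x j)) i
    emit-walk x j k i with f (window x j)
    ... | _ = refl

  walk-prepend : ∀ x j k l i → walk x j k l i ≡ prepend (toList l) (λ i′ → emit x (suc j) i′ k) i
  walk-prepend x j k (a List⁺.∷ _)        zero    = refl
  walk-prepend x j k (a List⁺.∷ [])       (suc i) = refl
  walk-prepend x j k (a List⁺.∷ (b ∷ as)) (suc i) = walk-prepend x j k (b List⁺.∷ as) i

  lookup?-blocks : ∀ x k j i → i < length (blocks x j k) → lookup? (blocks x j k) i ≡ just (emit x j i k)
  lookup?-blocks x zero    j i i<n = ⊥-elim (n≮0 (subst (i <_) (cong length (blocks-zero x j)) i<n))
  lookup?-blocks x (suc k) j i i<n rewrite blocks-suc x j k | emit-walk x j k i | walk-prepend x j k (f (window x j)) i =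
    lookup?-prepend (toList (f (window x j))) (blocks x (suc j) k) (lookup?-blocks x k (suc j)) i i<n

  lookup?-blocks-extend : ∀ x {K K′ i} → K ≤ K′ → i < length (blocks x 0 K) →
    lookup? (blocks x 0 K′) i ≡ lookup? (blocks x 0 K) i
  lookup?-blocks-extend x {K} {K′} {i} K≤K′ i<K = begin
    lookup? (blocks x 0 K′) i                             ≡⟨ cong (λ n → lookup? (blocks x 0 n) i) (sym (m+[n∸m]≡n K≤K′)) ⟩
    lookup? (blocks x 0 (K + (K′ ∸ K))) i                 ≡⟨ cong (λ l → lookup? l i) (blocks-+ x 0 K (K′ ∸ K)) ⟩
    lookup? (blocks x 0 K ++ blocks x K (K′ ∸ K)) i       ≡⟨ lookup?-++ˡ (blocks x 0 K) _ i<K ⟩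
    lookup? (blocks x 0 K) i                              ∎
    where open ≡-Reasoning

  lookup?-blocks-F : ∀ x K {i} → i < length (blocks x 0 K) → lookup? (blocks x 0 K) i ≡ just (F x i)
  lookup?-blocks-F x K {i} i<K with ≤-total K (suc i)
  ... | inj₁ K≤ = trans (sym (lookup?-blocks-extend x K≤ i<K)) (lookup?-blocks x (suc i) 0 i (n≤length-blocks x 0 (suc i)))
  ... | inj₂ ≤K = trans (lookup?-blocks-extend x ≤K (n≤length-blocks x 0 (suc i)))
                        (lookup?-blocks x (suc i) 0 i (n≤length-blocks x 0 (suc i)))

  blocks≡segment-F : ∀ x a n → blocks x a n ≡ segment (F x) (position x a) (length (blocks x a n))
  blocks≡segment-F x a n = ≡segment (F x) (position x a) (blocks x a n) λ i i<n → begin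
    lookup? (blocks x a n) i                                ≡⟨ sym (lookup?-++ʳ (blocks x 0 a) (blocks x a n) i) ⟩
    lookup? (blocks x 0 a ++ blocks x a n) (position x a + i) ≡⟨ cong (λ l → lookup? l (position x a + i)) (sym (blocks-+ x 0 a n)) ⟩
    lookup? (blocks x 0 (a + n)) (position x a + i)         ≡⟨ lookup?-blocks-F x (a + n)
                                                                (subst (position x a + i <_) (sym (position-+ x a n))
                                                                  (+-monoʳ-< (position x a) i<n)) ⟩
    just (F x (position x a + i))                           ∎
    where open ≡-Reasoning

  position-offset : DiamondUniform → ∀ x y j → position x j ≤ position y j + (M * θ + M * θ)
  position-offset DU x y j with ≤-total (θ + θ) (j + t)
  ... | inj₂ short = ≤-trans (length-fstarL (segment x 0 (j + t))) (≤-trans (*-monoʳ-≤ M (begin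
      length (segment x 0 (j + t)) ∸ t ≤⟨ m∸n≤m _ t ⟩
      length (segment x 0 (j + t))     ≡⟨ length-segment x 0 (j + t) ⟩
      j + t                            ≤⟨ short ⟩
      θ + θ                            ∎)) (≤-trans (≤-reflexive (*-distribˡ-+ M θ θ)) (m≤n+m _ (position y j))))
    where open ≤-Reasoning
  ... | inj₁ long = begin
      position x j                                        ≡⟨ cong (length ∘ fstarL) (three x) ⟩
      length (fstarL (px ++ mx ++ sx))                    ≤⟨ proj₂ (length-fstarL-infix px mx sx) ⟩
      M * length px + length (fstarL mx) + M * length sx  ≡⟨ cong₂ (λ a b → M * a + length (fstarL mx) + M * b)
                                                              (length-segment x 0 θ) (length-segment x (θ + r) θ) ⟩
      M * θ + length (fstarL mx) + M * θ                  ≤⟨ +-monoˡ-≤ (M * θ)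
                                                              (+-monoʳ-≤ (M * θ) (proj₁ (length-fstarL-infix py mx sy))) ⟩
      M * θ + length (fstarL (py ++ mx ++ sy)) + M * θ    ≡⟨ cong (λ z → M * θ + z + M * θ) hybrid≡y ⟩
      M * θ + position y j + M * θ                        ≡⟨ solve 2 (λ a p → a :+ p :+ a := p :+ (a :+ a)) refl (M * θ) (position y j) ⟩
      position y j + (M * θ + M * θ)                      ∎
    where
    open ≤-Reasoning
    open +-*-Solver
    r = (j + t) ∸ (θ + θ)
    j+t≡ : j + t ≡ θ + (r + θ)
    j+t≡ = trans (sym (m+[n∸m]≡n long)) (solve 2 (λ a b → (a :+ a) :+ b := a :+ (b :+ a)) refl θ r)
    three : ∀ z → segment z 0 (j + t) ≡ segment z 0 θ ++ segment z θ r ++ segment z (θ + r) θ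
    three z = trans (cong (segment z 0) j+t≡) (segment-+₃ z 0 θ r θ)
    px = segment x 0 θ
    mx = segment x θ r
    sx = segment x (θ + r) θ
    py = segment y 0 θ
    my = segment y θ r
    sy = segment y (θ + r) θ
    hybrid≡y : length (fstarL (py ++ mx ++ sy)) ≡ position y j
    hybrid≡y = trans (fstarL-middle-invariant DU py mx my sy (≤-reflexive (sym (length-segment y 0 θ)))
                       (≤-reflexive (sym (length-segment y (θ + r) θ))) (trans (length-segment x θ r) (sym (length-segment y θ r))))
                     (cong (length ∘ fstarL) (sym (three y)))

  C : ℕ
  C = M + (M * θ + M * θ)

  position-slowlyIncreasing : ∀ x → SlowlyIncreasing (position x) M
  position-slowlyIncreasing x = record
    { start = position-zero x ; unbounded = n≤length-blocks x 0 ; step = position-suc x }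

  record Framing (x : ℕ → A) (a n k ℓ : ℕ) : Set where
    constructor framing
    field
      {before after} : List A
      split          : blocks x a n ≡ before ++ segment (F x) k ℓ ++ after
      margin         : length before + length after ≤ C + C

  length-framed : ∀ {x a n k ℓ} (φ : Framing x a n k ℓ) →
    length (blocks x a n) ≡ ℓ + (length (Framing.before φ) + length (Framing.after φ))
  length-framed {x} {a} {n} {k} {ℓ} (framing {p} {r} split _) = begin
    length (blocks x a n)                            ≡⟨ cong length split ⟩
    length (p ++ segment (F x) k ℓ ++ r)             ≡⟨ length-++₃ p _ r ⟩
    length p + (length (segment (F x) k ℓ) + length r) ≡⟨ cong (λ z → length p + (z + length r)) (length-segment (F x) k ℓ) ⟩
    length p + (ℓ + length r)                        ≡⟨ x∙yz≈y∙xz (length p) ℓ (length r) ⟩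
    ℓ + (length p + length r)                        ∎
    where open ≡-Reasoning

  blocks-framing : ∀ x a n k ℓ → position x a ≤ k → k ≤ position x a + C →
    k + ℓ ≤ position x (a + n) → position x (a + n) ≤ k + ℓ + C → Framing x a n k ℓ
  blocks-framing x a n k ℓ start≤k k≤start+C kℓ≤end end≤kℓ+C
    with segment-infix (F x) (position x a) (length (blocks x a n)) k ℓ start≤k
                       (subst (k + ℓ ≤_) (position-+ x a n) kℓ≤end)
  ... | p , r , split , p≡ , length≡ =
    framing {before = p} {after = r} (trans (blocks≡segment-F x a n) split) (+-mono-≤ p≤C r≤C)
    where
    p≤C : length p ≤ C
    p≤C = subst (_≤ C) (sym p≡) (m≤n+o⇒m∸n≤o k (position x a) k≤start+C)
    r≤C : length r ≤ C
    r≤C = +-cancelˡ-≤ (k + ℓ) _ _ (begin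
      k + ℓ + length r                              ≡⟨ cong (λ z → z + ℓ + length r)
                                                         (sym (trans (cong (position x a +_) p≡) (m+[n∸m]≡n start≤k))) ⟩
      position x a + length p + ℓ + length r        ≡⟨ solve 4 (λ s p l r → s :+ p :+ l :+ r := s :+ (p :+ (l :+ r)))
                                                         refl (position x a) (length p) ℓ (length r) ⟩
      position x a + (length p + (ℓ + length r))    ≡⟨ cong (position x a +_) length≡ ⟩
      position x a + length (blocks x a n)          ≡⟨ sym (position-+ x a n) ⟩
      position x (a + n)                            ≤⟨ end≤kℓ+C ⟩
      k + ℓ + C                                     ∎)
      where
      open ≤-Reasoning
      open +-*-Solver

  framing-exists : DiamondUniform → ∀ x y k ℓ → 1 ≤ ℓ → ∃[ a ] ∃[ n ] (Framing x a n k ℓ × Framing y a n k ℓ)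
  framing-exists DU x y k ℓ 1≤ℓ
    with common-index-below Px Py (position-offset DU x y) (position-offset DU y x) k
       | common-index-above Px Py (position-offset DU x y) (position-offset DU y x) (k + ℓ) (≤-trans 1≤ℓ (m≤n+m ℓ k))
    where
    Px = position-slowlyIncreasing x
    Py = position-slowlyIncreasing y
  ... | a , xa≤k , ya≤k , k≤xa+C , k≤ya+C | b , kℓ≤xb , kℓ≤yb , xb≤kℓ+C , yb≤kℓ+C =
    a , b ∸ a , frame x xa≤k k≤xa+C kℓ≤xb xb≤kℓ+C , frame y ya≤k k≤ya+C kℓ≤yb yb≤kℓ+C
    where
    a≤b : a ≤ b
    a≤b with a ≤? b
    ... | yes a≤b = a≤b
    ... | no a≰b  = ⊥-elim (<⇒≱ (<-≤-trans (m<m+n k 1≤ℓ) kℓ≤xb) (≤-trans (position-mono x (<⇒≤ (≰⇒> a≰b))) xa≤k))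
    frame : ∀ z → position z a ≤ k → k ≤ position z a + C → k + ℓ ≤ position z b → position z b ≤ k + ℓ + C →
      Framing z a (b ∸ a) k ℓ
    frame z za≤k k≤za+C kℓ≤zb zb≤kℓ+C = blocks-framing z a (b ∸ a) k ℓ za≤k k≤za+C
      (subst (k + ℓ ≤_) (sym zb≡) kℓ≤zb) (subst (_≤ k + ℓ + C) (sym zb≡) zb≤kℓ+C)
      where zb≡ = cong (position z) (m+[n∸m]≡n a≤b)

  framed-length-bounds : ∀ {m x a n k ℓ} → (∀ u → m ≤ List⁺.length (f u)) → Framing x a n k ℓ →
    ℓ ≤ n * M × n * m ≤ ℓ + (C + C)
  framed-length-bounds {m} {x} {a} {n} {k} {ℓ} f≥m φ =
    ≤-trans (m≤m+n ℓ _) (≤-trans (≤-reflexive (sym (length-framed φ))) (length-blocks-≤ x a n)) ,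
    ≤-trans (length-blocks-≥ f≥m x a n) (≤-trans (≤-reflexive (length-framed φ)) (+-monoʳ-≤ ℓ (Framing.margin φ)))

  framed-common-sublist : ∀ {x y a n k ℓ} {w : List A} → Framing x a n k ℓ → Framing y a n k ℓ →
    w ⊆ segment x a (n + t) → w ⊆ segment y a (n + t) →
    ∃[ W ] (W ⊆ segment (F x) k ℓ × W ⊆ segment (F y) k ℓ × (ℓ + ℓ) ∸ (length W + length W) ≤
      (((n + t) + (n + t)) ∸ (length w + length w)) * K + (C + C + (C + C)))
  framed-common-sublist {x} {y} {a} {n} {k} {ℓ} {w} φx@(framing {px} {rx} split-x margin-x)
                        φy@(framing {py} {ry} split-y margin-y) w⊆u w⊆v
    with fstarL-common-sublist w⊆u w⊆v
  ... | W , W⊆Bx , W⊆By , images≤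
    with ⊆-common-infix px (segment (F x) k ℓ) rx py (segment (F y) k ℓ) ry
                       (subst (W ⊆_) split-x W⊆Bx) (subst (W ⊆_) split-y W⊆By)
  ... | W′ , W′⊆ , W′⊆′ , W≤ = W′ , W′⊆ , W′⊆′ , m≤n+o⇒m∸n≤o (ℓ + ℓ) (length W′ + length W′)
    (margin-cancel {ℓ} {length px + length rx} {length py + length ry} {length W} {length W′}
      (subst₂ (λ p q → p + q ≤ (length W + length W) + D * K) (length-framed φx) (length-framed φy)
        (subst (λ z → length (blocks x a n) + length (blocks y a n) ≤ (length W + length W) + (z ∸ (length w + length w)) * K)
          (cong₂ _+_ (length-segment x a (n + t)) (length-segment y a (n + t))) images≤))
      W≤ (+-mono-≤ margin-x margin-y))
    where D = ((n + t) + (n + t)) ∸ (length w + length w)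

  F-WithinEventually : DiamondUniform → ∀ {m} → (∀ u → m ≤ List⁺.length (f u)) → 1 ≤ m →
    ∀ x y (q r : ℚ) → WithinEventually x y q → ℕ→ℚ K ℚ.* q ℚ.< r ℚ.* ℕ→ℚ m → WithinEventually (F x) (F y) r
  F-WithinEventually DU {m} f≥m 1≤m x y q r (N , x≈y) Kq<rm = suc (N₀ + N * M) , within
    where
    c = C + C + (C + C) + (C + C + m * t)
    N₀ = proj₁ (rescaled-bound q r K m c 1≤m Kq<rm)
    within : ∀ ℓ → suc (N₀ + N * M) ≤ ℓ → ∀ k → dL≤ (factor (F x) k ℓ) (factor (F y) k ℓ) (r ℚ.* ℕ→ℚ ℓ)
    within ℓ ℓ≥ k = through (framing-exists DU x y k ℓ (≤-trans (s≤s z≤n) ℓ≥))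
      where
      through : ∃[ a ] ∃[ n ] (Framing x a n k ℓ × Framing y a n k ℓ) →
        dL≤ (factor (F x) k ℓ) (factor (F y) k ℓ) (r ℚ.* ℕ→ℚ ℓ)
      through (a , n , φx , φy) = Equivalence.from (dL≤-factor⇔ (F x) (F y) k ℓ {r ℚ.* ℕ→ℚ ℓ})
        (close-output (Equivalence.to (dL≤-factor⇔ x y a L {q ℚ.* ℕ→ℚ L}) (x≈y L N≤L a)))
        where
        L = n + t
        ℓ≤nM = proj₁ (framed-length-bounds f≥m φx)
        N≤L : N ≤ L
        N≤L = ≤-trans (*-cancelʳ-≤ N n M {{>-nonZero (≤-trans (s≤s z≤n) (f-bounded (window x 0)))}}
          (≤-trans (≤-trans (≤-trans (m≤n+m (N * M) N₀) (n≤1+n _)) ℓ≥) ℓ≤nM)) (m≤m+n n t)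
        1≤L : 1 ≤ L
        1≤L = ≤-trans (n≢0 n (≤-trans (≤-trans (s≤s z≤n) ℓ≥) ℓ≤nM)) (m≤m+n n t)
          where
          n≢0 : ∀ n → 1 ≤ n * M → 1 ≤ n
          n≢0 (suc _) _ = s≤s z≤n
        mL≤ℓ+c : m * L ≤ ℓ + c
        mL≤ℓ+c = begin
          m * (n + t)             ≡⟨ trans (*-distribˡ-+ m n t) (cong (_+ m * t) (*-comm m n)) ⟩
          n * m + m * t           ≤⟨ +-monoˡ-≤ (m * t) (proj₂ (framed-length-bounds f≥m φx)) ⟩
          ℓ + (C + C) + m * t     ≡⟨ +-assoc ℓ (C + C) (m * t) ⟩
          ℓ + (C + C + m * t)     ≤⟨ +-monoʳ-≤ ℓ (m≤n+m _ (C + C + (C + C))) ⟩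
          ℓ + c                   ∎
          where open ≤-Reasoning
        close-output : SegmentsWithin x y a L (q ℚ.* ℕ→ℚ L) → SegmentsWithin (F x) (F y) k ℓ (r ℚ.* ℕ→ℚ ℓ)
        close-output (w , w⊆u , w⊆v , D≤) = close (framed-common-sublist φx φy w⊆u w⊆v)
          where
          D = (L + L) ∸ (length w + length w)
          close : ∃[ W ] (W ⊆ segment (F x) k ℓ × W ⊆ segment (F y) k ℓ ×
                    (ℓ + ℓ) ∸ (length W + length W) ≤ D * K + (C + C + (C + C))) →
                  SegmentsWithin (F x) (F y) k ℓ (r ℚ.* ℕ→ℚ ℓ)
          close (W , W⊆ , W⊆′ , D′≤) = W , W⊆ , W⊆′ , proj₂ (rescaled-bound q r K m c 1≤m Kq<rm)
            ℓ L D ((ℓ + ℓ) ∸ (length W + length W)) (≤-trans (≤-trans (m≤m+n N₀ _) (n≤1+n _)) ℓ≥) 1≤L D≤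
            (≤-trans D′≤ (+-monoʳ-≤ (D * K) (m≤m+n (C + C + (C + C)) (C + C + m * t)))) mL≤ℓ+c

proposition3 : ∀ {n θ : ℕ} → 1 ≤ θ → (f : Vec (Fin n) θ → List⁺ (Fin n)) →
    (m M : ℕ) → Dill.IsMinNorm f m → Dill.IsMaxNorm f M → Dill.DiamondUniform f →
    (x y : ℕ → Fin n) → (q r : ℚ) →
    WithinEventually x y q →
    ℕ→ℚ ((2 * θ ∸ 1) * M) ℚ.* q ℚ.< r ℚ.* ℕ→ℚ m →
    WithinEventually (Dill.F f x) (Dill.F f y) r
proposition3 {θ = suc t} _ f m M (f≥m , u₀ , ∣fu₀∣≡m) (f≤M , _) DU x y q r x≈y Kq<rm =
  F-WithinEventually DU f≥m (subst (1 ≤_) ∣fu₀∣≡m (s≤s z≤n)) x y q r x≈y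
    (subst (λ z → ℕ→ℚ z ℚ.* q ℚ.< r ℚ.* ℕ→ℚ m) [2θ∸1]M≡K Kq<rm)
  where
  open DillMap f f≤M
  open +-*-Solver
  [2θ∸1]M≡K : (2 * suc t ∸ 1) * M ≡ K
  [2θ∸1]M≡K = solve 2 (λ t m → (t :+ (con 1 :+ t :+ con 0)) :* m := m :+ (t :* m :+ t :* m)) refl t M
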